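{- Let $n\ge 2$, $2\le i\le n$, $m\ge1$, let $Q\in B^{i,m}$ be non-zero, let $k$ be the smallest row index such that row $k$ of $Q$ is non-zero, and let $R$ be obtained from $Q$ by replacing row $k$ by zeros. Let $R(i):=f_i^{\varphi_i}(R)$ and $R(p):=f_p^{\varphi_p}(R(p+1))$ for $2\le p\le i-1$. Then for all $2\le p\le i$, $\sum_{j=i}^n R(p)_{p,j}=m$. In particular $S^{R(p)}(p-1,i)=M^{R(p)}(p-1)=m$ for all $2\le p\le i$.
   Context: $B^{i,m}$ is the set of arrays $A=(a_{p,q})$ of non-negative integers indexed by $1\le p\le i$ (column index), $i\le q\le n$ (row index; row $q$ is $(a_{1,q},\dots,a_{i,q})$), with $\sum_{r=1}^n a_{\beta(r)}\le m$ for every Dyck path $\beta$ (positions $\beta(1)=(1,i),\dots,\beta(n)=(i,n)$ with $\beta(r+1)\in\{(a,b+1),(a+1,b)\}$ if $\beta(r)=(a,b)$); $a_{p,q}=0$ outside the range. Crystal operators for $\ell\in\{1,\dots,n\}$: (i) $\ell=i$: $\varphi_i(A)=m-\sum_{j=1}^{i-1}a_{j,i}-\sum_{j=i}^n a_{i,j}$; $f_i$ increases $a_{i,i}$ by 1. (ii) $\ell<i$: with $U_p=\sum_{j=i}^p a_{\ell,j}+\sum_{j=p}^n a_{\ell+1,j}$ ($i\le p\le n$) and $p_-$ the largest maximizer, $\varphi_\ell(A)=\sum_{j=p_- }^n a_{\ell+1,j}-\sum_{j=p_-+1}^n a_{\ell,j}$, and $f_\ell$ increases $a_{\ell,p_-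 }$ by 1 and decreases $a_{\ell+1,p_- }$ by 1 (undefined if $\varphi_\ell(A)=0$). $f_j^{\varphi_j}(B)$ means $f_j^{\varphi_j(B)}(B)$. For an array $B$ and $1\le s<i\le r\le n$: $S^B(s,r)=\sum_{j=i}^r b_{s,j}+\sum_{j=r}^n b_{s+1,j}$ (sum over the step path $(s,i),\dots,(s,r),(s+1,r),\dots,(s+1,n)$), and $M^B(s)=\max_{i\le r\le n}S^B(s,r)$. $R(p)_{s,t}$ denotes the entry of $R(p)$ in column $s$ and row $t$. -}

module Defs where

open import Data.Nat using (ℕ; zero; suc; _+_; _∸_; _≤_; _<_; _<ᵇ_; _≟_)
open import Data.Nat.Properties using ()
open import Data.Bool using (Bool; true; false; if_then_else_)
open import Data.List using (List; []; _∷_; map; upTo)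
open import Data.Nat.ListAction using (sum)
open import Data.Maybe using (Maybe; just; nothing; _>>=_)
open import Data.Product using (_×_; _,_; ∃)
open import Data.Sum using (_⊎_)
open import Relation.Nullary using (yes; no; ¬_)
open import Relation.Binary.PropositionalEquality using (_≡_)

-- An array A = (a_{p,q}) : A p q is the entry in column p and row q.
Array : Set
Array = ℕ → ℕ → ℕ

-- Σ_{j=a}^{b} f j  (empty, i.e. 0, if b < a)
Σ[_⋯_] : ℕ → ℕ → (ℕ → ℕ) → ℕ
Σ[ a ⋯ b ] f = sum (map (λ t → f (a + t)) (upTo (suc b ∸ a)))

data Step : Set where
  rowStep colStep : Step

endPt : ℕ → ℕ → List Step → ℕ × ℕ
endPt a b [] = a , b
endPt a b (rowStep ∷ s) = endPt a (suc b) s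
endPt a b (colStep ∷ s) = endPt (suc a) b s

pathSum : Array → ℕ → ℕ → List Step → ℕ
pathSum A a b [] = A a b
pathSum A a b (rowStep ∷ s) = A a b + pathSum A a (suc b) s
pathSum A a b (colStep ∷ s) = A a b + pathSum A (suc a) b s

IsDyckPath : ℕ → ℕ → List Step → Set
IsDyckPath n i s = endPt 1 i s ≡ (i , n)

record InB (n i m : ℕ) (A : Array) : Set where
  field
    support : ∀ p q → ¬ (1 ≤ p × p ≤ i × i ≤ q × q ≤ n) → A p q ≡ 0
    dyck    : ∀ s → IsDyckPath n i s → pathSum A 1 i s ≤ m

RowNonZero : ℕ → Array → ℕ → Set
RowNonZero i A q = ∃ λ p → 1 ≤ p × p ≤ i × ¬ (A p q ≡ 0)

NonZeroArray : Array → Set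
NonZeroArray A = ∃ λ p → ∃ λ q → ¬ (A p q ≡ 0)

zeroRow : ℕ → Array → Array
zeroRow k A p q with q ≟ k
... | yes _ = 0
... | no  _ = A p q

modify : ℕ → ℕ → (ℕ → ℕ) → Array → Array
modify p q g A p' q' with p' ≟ p | q' ≟ q
... | yes _ | yes _ = g (A p' q')
... | _     | _     = A p' q'

-- largest maximizer of U over a, a+1, ..., a+c
lastArgmax : (ℕ → ℕ) → ℕ → ℕ → ℕ
lastArgmax U a zero = a
lastArgmax U a (suc c) =
  let b = lastArgmax U (suc a) c in
  if U b <ᵇ U a then a else b

U : ℕ → ℕ → ℕ → Array → ℕ → ℕ
U n i ℓ A p = Σ[ i ⋯ p ] (A ℓ) + Σ[ p ⋯ n ] (A (suc ℓ))

pMinus : ℕ → ℕ → ℕ → Array → ℕ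
pMinus n i ℓ A = lastArgmax (U n i ℓ A) i (n ∸ i)

-- φ_ℓ (for ℓ ≤ i); values are non-negative on B^{i,m}
φ : ℕ → ℕ → ℕ → ℕ → Array → ℕ
φ n i m ℓ A with ℓ ≟ i
... | yes _ = m ∸ (Σ[ 1 ⋯ i ∸ 1 ] (λ j → A j i) + Σ[ i ⋯ n ] (A i))
... | no  _ = let p = pMinus n i ℓ A in
              Σ[ p ⋯ n ] (A (suc ℓ)) ∸ Σ[ suc p ⋯ n ] (A ℓ)

f : ℕ → ℕ → ℕ → ℕ → Array → Maybe Array
f n i m ℓ A with φ n i m ℓ A
... | zero = nothing
... | suc _ with ℓ ≟ i
...   | yes _ = just (modify i i suc A)
...   | no  _ = let p = pMinus n i ℓ A in
                just (modify (suc ℓ) p (λ x → x ∸ 1) (modify ℓ p suc A))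

iterM : ℕ → (Array → Maybe Array) → Array → Maybe Array
iterM zero    g A = just A
iterM (suc k) g A = g A >>= iterM k g

-- f_j^{φ_j}(B) = f_j^{φ_j(B)}(B)
fφ : ℕ → ℕ → ℕ → ℕ → Array → Maybe Array
fφ n i m j B = iterM (φ n i m j B) (f n i m j) B

-- chain d = R(i ∸ d):  R(i) = f_i^{φ_i}(R),  R(p) = f_p^{φ_p}(R(p+1))
Rchain : ℕ → ℕ → ℕ → Array → ℕ → Maybe Array
Rchain n i m R zero    = fφ n i m i R
Rchain n i m R (suc d) = Rchain n i m R d >>= fφ n i m (i ∸ suc d)

S : ℕ → ℕ → Array → ℕ → ℕ → ℕ
S n i B s r = Σ[ i ⋯ r ] (B s) + Σ[ r ⋯ n ] (B (suc s))

M : ℕ → ℕ → Array → ℕ → ℕ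
M n i B s = lastMax (n ∸ i) i
  where
  lastMax : ℕ → ℕ → ℕ
  lastMax zero    r = S n i B s r
  lastMax (suc c) r = let x = S n i B s r ; y = lastMax c (suc r) in
                      if x <ᵇ y then y else x

-- Erasing the first
-- non-zero row k of Q leaves row i of R zero left of the diagonal.  The only paths through
-- (i,i) follow row i and then column i, with value m - φ_i, so raising a_{i,i} φ_i times
-- keeps R in B^{i,m} and fills column i up to m.  For ℓ < i, f_ℓ moves one unit from
-- (ℓ+1,p₋) to (ℓ,p₋).  The paths that gain from this turn from column ℓ to column ℓ+1 at a
-- row t > p₋, and bending them to turn at p₋ gives a path at least as large, because p₋ is
-- the last maximiser of U.  So B^{i,m} is preserved, max U stays equal to m, and
-- φ_ℓ + Σ_j a_{ℓ,j} = max U forces column ℓ to sum to m once φ_ℓ is used up.  Finally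
-- S(p-1,i) = a_{p-1,i} + m = m, while every S(p-1,r) is part of a path value, so M(p-1) = m.

{-# OPTIONS --safe #-}
module Submission where

open import Defs
open import Data.Bool using (true; false; if_then_else_)
open import Data.Empty using (⊥-elim)
open import Data.List using (List; []; _∷_; _++_; replicate; applyUpTo)
open import Data.List.Properties using (map-upTo; applyUpTo-∷ʳ)
open import Data.Maybe using (Maybe; just; _>>=_)
open import Data.Nat
open import Data.Nat.ListAction using (sum)
open import Data.Nat.ListAction.Properties using (sum-++)
open import Data.Nat.Properties
open import Data.Nat.Solver using (module +-*-Solver)
open import Data.Product using (∃; _×_; _,_)
open import Data.Sum using (_⊎_; inj₁; inj₂; [_,_])
open import Function using (_∘_)
open import Relation.Binary.Definitions using (Tri; tri<; tri≈; tri>)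
open import Relation.Binary.PropositionalEquality hiding ([_])
open import Relation.Nullary using (¬_; Dec; yes; no)
open import Relation.Nullary.Reflects using (ofʸ; ofⁿ)

sum-applyUpTo-cong : ∀ {g h : ℕ → ℕ} l → (∀ {t} → t < l → g t ≡ h t) →
  sum (applyUpTo g l) ≡ sum (applyUpTo h l)
sum-applyUpTo-cong zero    g≡h = refl
sum-applyUpTo-cong (suc l) g≡h = cong₂ _+_ (g≡h z<s) (sum-applyUpTo-cong l (g≡h ∘ s<s))

sum-applyUpTo-mono : ∀ {g h : ℕ → ℕ} l → (∀ {t} → t < l → g t ≤ h t) →
  sum (applyUpTo g l) ≤ sum (applyUpTo h l)
sum-applyUpTo-mono zero    g≤h = z≤n
sum-applyUpTo-mono (suc l) g≤h = +-mono-≤ (g≤h z<s) (sum-applyUpTo-mono l (g≤h ∘ s<s))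

sum-applyUpTo-+ : ∀ (g : ℕ → ℕ) l₁ l₂ →
  sum (applyUpTo g (l₁ + l₂)) ≡ sum (applyUpTo g l₁) + sum (applyUpTo (g ∘ (l₁ +_)) l₂)
sum-applyUpTo-+ g zero     l₂ = refl
sum-applyUpTo-+ g (suc l₁) l₂ =
  trans (cong (g 0 +_) (sum-applyUpTo-+ (g ∘ suc) l₁ l₂)) (sym (+-assoc (g 0) _ _))

sum-applyUpTo-suc : ∀ (g : ℕ → ℕ) l → sum (applyUpTo g (suc l)) ≡ sum (applyUpTo g l) + g l
sum-applyUpTo-suc g l = begin
  sum (applyUpTo g (suc l))             ≡⟨ cong sum (applyUpTo-∷ʳ g l) ⟨
  sum (applyUpTo g l ++ g l ∷ [])       ≡⟨ sum-++ (applyUpTo g l) (g l ∷ []) ⟩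
  sum (applyUpTo g l) + (g l + 0)       ≡⟨ cong (sum (applyUpTo g l) +_) (+-identityʳ (g l)) ⟩
  sum (applyUpTo g l) + g l             ∎
  where open ≡-Reasoning

adjacent≤sum-applyUpTo : ∀ (g : ℕ → ℕ) {l} d → suc d < l → g d + g (suc d) ≤ sum (applyUpTo g l)
adjacent≤sum-applyUpTo g {suc (suc l)} zero    _ =
  +-monoʳ-≤ (g 0) (m≤m+n (g 1) _)
adjacent≤sum-applyUpTo g {suc l}       (suc d) (s<s d<l) =
  ≤-trans (adjacent≤sum-applyUpTo (g ∘ suc) d d<l) (m≤n+m _ (g 0))

sum-applyUpTo-mono-adjacent : ∀ {g h : ℕ → ℕ} {l} d → suc d < l →
  (∀ {t} → t < l → t ≢ d → t ≢ suc d → g t ≡ h t) → g d + g (suc d) ≤ h d + h (suc d) →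
  sum (applyUpTo g l) ≤ sum (applyUpTo h l)
sum-applyUpTo-mono-adjacent {g} {h} {suc (suc l)} zero _ g≡h pair≤ = begin
  g 0 + (g 1 + sum (applyUpTo (g ∘ suc ∘ suc) l)) ≡⟨ +-assoc (g 0) _ _ ⟨
  g 0 + g 1 + sum (applyUpTo (g ∘ suc ∘ suc) l)   ≤⟨ +-mono-≤ pair≤ (≤-reflexive rest) ⟩
  h 0 + h 1 + sum (applyUpTo (h ∘ suc ∘ suc) l)   ≡⟨ +-assoc (h 0) _ _ ⟩
  h 0 + (h 1 + sum (applyUpTo (h ∘ suc ∘ suc) l)) ∎
  where
  open ≤-Reasoning
  rest = sum-applyUpTo-cong l (λ t<l → g≡h (s<s (s<s t<l)) (λ ()) (λ ()))
sum-applyUpTo-mono-adjacent {g} {h} {suc l} (suc d) (s<s d<l) g≡h pair≤ =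
  +-mono-≤ (≤-reflexive (g≡h z<s (λ ()) (λ ())))
    (sum-applyUpTo-mono-adjacent d d<l
      (λ t<l t≢d t≢sd → g≡h (s<s t<l) (t≢d ∘ suc-injective) (t≢sd ∘ suc-injective)) pair≤)

<∸⇒+< : ∀ a {b t} → t < b ∸ a → a + t < b
<∸⇒+< zero            t<b   = t<b
<∸⇒+< (suc a) {suc b} t<b∸a = s<s (<∸⇒+< a t<b∸a)

Σ-as-sum : ∀ f a b → Σ[ a ⋯ b ] f ≡ sum (applyUpTo (λ t → f (a + t)) (suc b ∸ a))
Σ-as-sum f a b = cong sum (map-upTo (λ t → f (a + t)) (suc b ∸ a))

Σ-cong : ∀ {f g : ℕ → ℕ} a b → (∀ {j} → a ≤ j → j ≤ b → f j ≡ g j) → Σ[ a ⋯ b ] f ≡ Σ[ a ⋯ b ] g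
Σ-cong {f} {g} a b f≡g = begin
  Σ[ a ⋯ b ] f                                  ≡⟨ Σ-as-sum f a b ⟩
  sum (applyUpTo (λ t → f (a + t)) (suc b ∸ a)) ≡⟨ sum-applyUpTo-cong (suc b ∸ a) inRange ⟩
  sum (applyUpTo (λ t → g (a + t)) (suc b ∸ a)) ≡⟨ Σ-as-sum g a b ⟨
  Σ[ a ⋯ b ] g                                  ∎
  where
  open ≡-Reasoning
  inRange : ∀ {t} → t < suc b ∸ a → f (a + t) ≡ g (a + t)
  inRange {t} t<l = f≡g (m≤m+n a t) (s≤s⁻¹ (<∸⇒+< a t<l))

Σ-mono : ∀ {f g : ℕ → ℕ} a b → (∀ j → f j ≤ g j) → Σ[ a ⋯ b ] f ≤ Σ[ a ⋯ b ] g
Σ-mono {f} {g} a b f≤g = begin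
  Σ[ a ⋯ b ] f                                  ≡⟨ Σ-as-sum f a b ⟩
  sum (applyUpTo (λ t → f (a + t)) (suc b ∸ a)) ≤⟨ sum-applyUpTo-mono (suc b ∸ a) (λ {t} _ → f≤g (a + t)) ⟩
  sum (applyUpTo (λ t → g (a + t)) (suc b ∸ a)) ≡⟨ Σ-as-sum g a b ⟨
  Σ[ a ⋯ b ] g                                  ∎
  where open ≤-Reasoning

Σ-singleton : ∀ f a → Σ[ a ⋯ a ] f ≡ f a
Σ-singleton f a = begin
  Σ[ a ⋯ a ] f                                  ≡⟨ Σ-as-sum f a a ⟩
  sum (applyUpTo (λ t → f (a + t)) (suc a ∸ a)) ≡⟨ cong (sum ∘ applyUpTo _) (m+n∸n≡m 1 a) ⟩
  f (a + 0) + 0                                 ≡⟨ +-identityʳ _ ⟩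
  f (a + 0)                                     ≡⟨ cong f (+-identityʳ a) ⟩
  f a                                           ∎
  where open ≡-Reasoning

Σ-empty : ∀ f b → Σ[ suc b ⋯ b ] f ≡ 0
Σ-empty f b rewrite n∸n≡0 b = refl

Σ-split : ∀ f {a b} c → a ≤ suc c → c ≤ b → Σ[ a ⋯ b ] f ≡ Σ[ a ⋯ c ] f + Σ[ suc c ⋯ b ] f
Σ-split f {a} {b} c a≤sc c≤b = begin
  Σ[ a ⋯ b ] f                                                   ≡⟨ Σ-as-sum f a b ⟩
  sum (applyUpTo g (suc b ∸ a))                                  ≡⟨ cong (sum ∘ applyUpTo g) lengths ⟩
  sum (applyUpTo g ((suc c ∸ a) + (suc b ∸ suc c)))              ≡⟨ sum-applyUpTo-+ g (suc c ∸ a) _ ⟩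
  sum (applyUpTo g (suc c ∸ a)) + sum (applyUpTo (g ∘ ((suc c ∸ a) +_)) (suc b ∸ suc c))
                                                                 ≡⟨ cong₂ _+_ (Σ-as-sum f a c) (sum-applyUpTo-cong _ shift) ⟨
  Σ[ a ⋯ c ] f + sum (applyUpTo (λ t → f (suc c + t)) (suc b ∸ suc c))
                                                                 ≡⟨ cong (Σ[ a ⋯ c ] f +_) (Σ-as-sum f (suc c) b) ⟨
  Σ[ a ⋯ c ] f + Σ[ suc c ⋯ b ] f                                ∎
  where
  open ≡-Reasoning
  g = λ t → f (a + t)
  lengths : suc b ∸ a ≡ (suc c ∸ a) + (suc b ∸ suc c)
  lengths = trans (cong (_∸ a) (sym (m+[n∸m]≡n (s≤s c≤b)))) (+-∸-comm _ a≤sc)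
  shift : ∀ {t} → t < suc b ∸ suc c → f (suc c + t) ≡ g ((suc c ∸ a) + t)
  shift {t} _ = cong f (trans (cong (_+ t) (sym (m+[n∸m]≡n a≤sc))) (+-assoc a _ t))

Σ-snoc : ∀ f {a b} → a ≤ b → Σ[ a ⋯ b ] f ≡ sum (applyUpTo (λ t → f (a + t)) (b ∸ a)) + f b
Σ-snoc f {a} {b} a≤b = begin
  Σ[ a ⋯ b ] f                                   ≡⟨ Σ-as-sum f a b ⟩
  sum (applyUpTo g (suc b ∸ a))                  ≡⟨ cong (sum ∘ applyUpTo g) (+-∸-assoc 1 a≤b) ⟩
  sum (applyUpTo g (suc (b ∸ a)))                ≡⟨ sum-applyUpTo-suc g (b ∸ a) ⟩
  sum (applyUpTo g (b ∸ a)) + f (a + (b ∸ a))    ≡⟨ cong (λ j → sum (applyUpTo g (b ∸ a)) + f j) (m+[n∸m]≡n a≤b) ⟩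
  sum (applyUpTo g (b ∸ a)) + f b                ∎
  where
  open ≡-Reasoning
  g = λ t → f (a + t)

Σ-incr : ∀ {f g : ℕ → ℕ} {a b} q → (∀ {j} → j ≢ q → g j ≡ f j) → g q ≡ suc (f q) →
  a ≤ q → q ≤ b → Σ[ a ⋯ b ] g ≡ suc (Σ[ a ⋯ b ] f)
Σ-incr {f} {g} {a} {b} q g≡f gq≡1+fq a≤q q≤b = begin
  Σ[ a ⋯ b ] g                                   ≡⟨ Σ-split g q (m≤n⇒m≤1+n a≤q) q≤b ⟩
  Σ[ a ⋯ q ] g + Σ[ suc q ⋯ b ] g                ≡⟨ cong (_+ Σ[ suc q ⋯ b ] g) (Σ-snoc g a≤q) ⟩
  before g + g q + Σ[ suc q ⋯ b ] g              ≡⟨ cong₂ (λ x y → x + y + Σ[ suc q ⋯ b ] g) beforeEq gq≡1+fq ⟩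
  before f + suc (f q) + Σ[ suc q ⋯ b ] g        ≡⟨ cong₂ _+_ (+-suc (before f) (f q)) (Σ-cong (suc q) b (λ q<j _ → g≡f (>⇒≢ q<j))) ⟩
  suc (before f + f q) + Σ[ suc q ⋯ b ] f        ≡⟨ cong (λ x → suc (x + _)) (Σ-snoc f a≤q) ⟨
  suc (Σ[ a ⋯ q ] f + Σ[ suc q ⋯ b ] f)          ≡⟨ cong suc (Σ-split f q (m≤n⇒m≤1+n a≤q) q≤b) ⟨
  suc (Σ[ a ⋯ b ] f)                             ∎
  where
  open ≡-Reasoning
  before : (ℕ → ℕ) → ℕ
  before h = sum (applyUpTo (λ t → h (a + t)) (q ∸ a))
  beforeEq : before g ≡ before f
  beforeEq = sum-applyUpTo-cong (q ∸ a) (λ t<q∸a → g≡f (<⇒≢ (<∸⇒+< a t<q∸a)))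

Σ-zero : ∀ {f} a b → (∀ {j} → a ≤ j → j ≤ b → f j ≡ 0) → Σ[ a ⋯ b ] f ≡ 0
Σ-zero a b f≡0 = trans (Σ-cong a b f≡0) (trans (Σ-as-sum (λ _ → 0) a b) (sum-zeros (suc b ∸ a)))
  where
  sum-zeros : ∀ l → sum (applyUpTo (λ _ → 0) l) ≡ 0
  sum-zeros zero    = refl
  sum-zeros (suc l) = sum-zeros l

-- S n i X ℓ t and U n i ℓ X t both unfold to twoColumnSum X ℓ i t n.
twoColumnSum : Array → ℕ → ℕ → ℕ → ℕ → ℕ
twoColumnSum X ℓ s t u = Σ[ s ⋯ t ] (X ℓ) + Σ[ t ⋯ u ] (X (suc ℓ))

corner-exchange : ∀ X ℓ {a s q t u b} → a ≤ q → s ≤ q → q ≤ t → t ≤ u → u ≤ b →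
  twoColumnSum X ℓ s t u + twoColumnSum X ℓ a q b ≡ twoColumnSum X ℓ s q u + twoColumnSum X ℓ a t b
corner-exchange X ℓ {a} {s} {q} {t} {u} {b} a≤q s≤q q≤t t≤u u≤b
  rewrite Σ-split (X ℓ) {s} {t} q (m≤n⇒m≤1+n s≤q) q≤t
        | Σ-split (X ℓ) {a} {t} q (m≤n⇒m≤1+n a≤q) q≤t
        | Σ-split (X (suc ℓ)) {q} {b} u (m≤n⇒m≤1+n (≤-trans q≤t t≤u)) u≤b
        | Σ-split (X (suc ℓ)) {t} {b} u (m≤n⇒m≤1+n t≤u) u≤b
  = solve 6 (λ x y z w p v → x :+ y :+ z :+ (p :+ (v :+ w)) := x :+ v :+ (p :+ y :+ (z :+ w))) refl
      (Σ[ s ⋯ q ] (X ℓ)) (Σ[ suc q ⋯ t ] (X ℓ)) (Σ[ t ⋯ u ] (X (suc ℓ))) (Σ[ suc u ⋯ b ] (X (suc ℓ)))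
      (Σ[ a ⋯ q ] (X ℓ)) (Σ[ q ⋯ u ] (X (suc ℓ)))
  where open +-*-Solver

corner-exchange-< : ∀ X ℓ {a s q t u b} → a ≤ q → s ≤ q → q ≤ t → t ≤ u → u ≤ b →
  twoColumnSum X ℓ a t b < twoColumnSum X ℓ a q b → twoColumnSum X ℓ s t u < twoColumnSum X ℓ s q u
corner-exchange-< X ℓ {a} {s} {q} {t} {u} {b} a≤q s≤q q≤t t≤u u≤b at-t<at-q =
  +-cancelʳ-< (twoColumnSum X ℓ a q b) _ _ (begin-strict
    twoColumnSum X ℓ s t u + twoColumnSum X ℓ a q b ≡⟨ corner-exchange X ℓ a≤q s≤q q≤t t≤u u≤b ⟩
    twoColumnSum X ℓ s q u + twoColumnSum X ℓ a t b <⟨ +-monoʳ-< (twoColumnSum X ℓ s q u) at-t<at-q ⟩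
    twoColumnSum X ℓ s q u + twoColumnSum X ℓ a q b ∎)
  where open ≤-Reasoning

twoColumnSum-step : ∀ X ℓ {a q b} → a ≤ suc q → q < b →
  twoColumnSum X ℓ a (suc q) b + X (suc ℓ) q ≡ twoColumnSum X ℓ a q b + X ℓ (suc q)
twoColumnSum-step X ℓ {a} {q} {b} a≤1+q q<b
  rewrite Σ-split (X ℓ) {a} {suc q} q a≤1+q (n≤1+n q)
        | Σ-singleton (X ℓ) (suc q)
        | Σ-split (X (suc ℓ)) {q} {b} q (n≤1+n q) (<⇒≤ q<b)
        | Σ-singleton (X (suc ℓ)) q
  = solve 4 (λ p x y z → p :+ x :+ z :+ y := p :+ (y :+ z) :+ x) refl
      (Σ[ a ⋯ q ] (X ℓ)) (X ℓ (suc q)) (X (suc ℓ) q) (Σ[ suc q ⋯ b ] (X (suc ℓ)))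
  where open +-*-Solver

modify-hit : ∀ p q g A → modify p q g A p q ≡ g (A p q)
modify-hit p q g A with p ≟ p | q ≟ q
... | yes _   | yes _   = refl
... | no p≢p  | _       = ⊥-elim (p≢p refl)
... | yes _   | no q≢q  = ⊥-elim (q≢q refl)

modify-miss : ∀ p q g A {p′ q′} → p′ ≢ p ⊎ q′ ≢ q → modify p q g A p′ q′ ≡ A p′ q′
modify-miss p q g A {p′} {q′} elsewhere with p′ ≟ p | q′ ≟ q | elsewhere
... | yes p′≡p | yes _    | inj₁ p′≢p = ⊥-elim (p′≢p p′≡p)
... | yes _    | yes q′≡q | inj₂ q′≢q = ⊥-elim (q′≢q q′≡q)
... | yes _    | no _     | _         = refl
... | no _     | _        | _         = refl

zeroRow-≤ : ∀ k A p q → zeroRow k A p q ≤ A p q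
zeroRow-≤ k A p q with q ≟ k
... | yes _ = z≤n
... | no  _ = ≤-refl

RowZeroBefore : Array → ℕ → ℕ → Set
RowZeroBefore X i ℓ = ∀ {c} → c < ℓ → X c i ≡ 0

zeroRow-RowZeroBefore : ∀ {n i m Q k} → InB n i m Q → i ≤ k →
  (∀ q → i ≤ q → q < k → ¬ RowNonZero i Q q) → RowZeroBefore (zeroRow k Q) i i
zeroRow-RowZeroBefore {i = i} {Q = Q} {k} inB i≤k minimal {c} c<i with i ≟ k
... | yes _   = refl
... | no  i≢k = entry c c<i
  where
  entry : ∀ c → c < i → Q c i ≡ 0
  entry zero    _   = InB.support inB 0 i (λ { (() , _) })
  entry (suc c) c<i with Q (suc c) i ≟ 0
  ... | yes Q≡0 = Q≡0
  ... | no  Q≢0 = ⊥-elim (minimal i ≤-refl (≤∧≢⇒< i≤k i≢k) (suc c , s≤s z≤n , <⇒≤ c<i , Q≢0))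

hookSum : ℕ → ℕ → Array → ℕ
hookSum n i X = Σ[ 1 ⋯ i ∸ 1 ] (λ j → X j i) + Σ[ i ⋯ n ] (X i)

moveLeft : ℕ → ℕ → Array → Array
moveLeft ℓ q X = modify (suc ℓ) q (λ x → x ∸ 1) (modify ℓ q suc X)

module _ (n i m : ℕ) (X : Array) where

  φ-diag : φ n i m i X ≡ m ∸ hookSum n i X
  φ-diag with i ≟ i
  ... | yes _   = refl
  ... | no i≢i  = ⊥-elim (i≢i refl)

  φ-off : ∀ {ℓ} → ℓ ≢ i →
    φ n i m ℓ X ≡ Σ[ pMinus n i ℓ X ⋯ n ] (X (suc ℓ)) ∸ Σ[ suc (pMinus n i ℓ X) ⋯ n ] (X ℓ)
  φ-off {ℓ} ℓ≢i with ℓ ≟ i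
  ... | yes ℓ≡i = ⊥-elim (ℓ≢i ℓ≡i)
  ... | no  _   = refl

  f-diag : ∀ {k} → φ n i m i X ≡ suc k → f n i m i X ≡ just (modify i i suc X)
  f-diag φ≡1+k with φ n i m i X
  f-diag refl | _ with i ≟ i
  ... | yes _   = refl
  ... | no i≢i  = ⊥-elim (i≢i refl)

  f-off : ∀ {ℓ k} → ℓ ≢ i → φ n i m ℓ X ≡ suc k → f n i m ℓ X ≡ just (moveLeft ℓ (pMinus n i ℓ X) X)
  f-off {ℓ} ℓ≢i φ≡1+k with φ n i m ℓ X
  f-off {ℓ} ℓ≢i refl | _ with ℓ ≟ i
  ... | yes ℓ≡i = ⊥-elim (ℓ≢i ℓ≡i)
  ... | no  _   = refl

iterM-countdown : ∀ (g : Array → Maybe Array) (P : ℕ → Array → Set) →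
  (∀ k X → P (suc k) X → ∃ λ Y → g X ≡ just Y × P k Y) →
  ∀ k X → P k X → ∃ λ Y → iterM k g X ≡ just Y × P 0 Y
iterM-countdown g P step zero    X PX = X , refl , PX
iterM-countdown g P step (suc k) X PX with step k X PX
... | Y , gX≡Y , PY with iterM-countdown g P step k Y PY
...   | Z , iterY≡Z , PZ = Z , trans (cong (_>>= iterM k g) gX≡Y) iterY≡Z , PZ

record IsLastArgmax (g : ℕ → ℕ) (a b q : ℕ) : Set where
  field
    lower   : a ≤ q
    upper   : q ≤ b
    maximal : ∀ {t} → a ≤ t → t ≤ b → g t ≤ g q
    last    : ∀ {t} → q < t → t ≤ b → g t < g q

lastArgmax-correct : ∀ g a c {b} → a + c ≡ b → IsLastArgmax g a b (lastArgmax g a c)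
lastArgmax-correct g a zero {b} refl = record
  { lower   = ≤-refl
  ; upper   = m≤m+n a 0
  ; maximal = λ a≤t t≤a+0 → ≤-reflexive (cong g (≤-antisym (≤-trans t≤a+0 (≤-reflexive (+-identityʳ a))) a≤t))
  ; last    = λ a<t t≤a+0 → ⊥-elim (<⇒≱ a<t (≤-trans t≤a+0 (≤-reflexive (+-identityʳ a))))
  }
lastArgmax-correct g a (suc c) {b} a+1+c≡b
  with lastArgmax g (suc a) c | lastArgmax-correct g (suc a) c (trans (sym (+-suc a c)) a+1+c≡b)
... | q | rest with g q <ᵇ g a | <ᵇ-reflects-< (g q) (g a)
...   | true  | ofʸ gq<ga = record
  { lower   = ≤-refl
  ; upper   = ≤-trans (n≤1+n a) (≤-trans lower upper)
  ; maximal = λ a≤t t≤b → [ (λ a<t → <⇒≤ (≤-<-trans (maximal a<t t≤b) gq<ga))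
                          , (λ a≡t → ≤-reflexive (cong g (sym a≡t))) ] (m≤n⇒m<n∨m≡n a≤t)
  ; last    = λ a<t t≤b → ≤-<-trans (maximal a<t t≤b) gq<ga
  }
  where open IsLastArgmax rest
...   | false | ofⁿ gq≮ga = record
  { lower   = ≤-trans (n≤1+n a) lower
  ; upper   = upper
  ; maximal = λ a≤t t≤b → [ (λ a<t → maximal a<t t≤b)
                          , (λ a≡t → subst (λ t → g t ≤ g q) a≡t (≮⇒≥ gq≮ga)) ] (m≤n⇒m<n∨m≡n a≤t)
  ; last    = last
  }
  where open IsLastArgmax rest

-- M's scanning loop is local to M; abstracting its arguments lets unification name it.
ScanOf : (ℕ → ℕ → Array → ℕ → ℕ → ℕ → ℕ → ℕ) → Set
ScanOf scan = ∀ n i B s c r a → r ≡ suc i → a ≡ S n i B s i → n ∸ i ≡ suc c →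
  M n i B s ≡ scan n i B s c r a

M-unfolds : ScanOf _
M-unfolds n i B s c .(suc i) .(S n i B s i) refl refl n∸i≡1+c with n ∸ i
M-unfolds n i B s c .(suc i) .(S n i B s i) refl refl refl | .(suc c) with S n i B s i
... | a with suc i
... | r = refl

scanOf : ∀ {scan} → ScanOf scan → ℕ → ℕ → Array → ℕ → ℕ → ℕ → ℕ → ℕ
scanOf {scan} _ = scan

keepMax : ℕ → ℕ → ℕ
keepMax a y = if a <ᵇ y then y else a

keepMax-≤ : ∀ {a y m} → a ≤ m → y ≤ m → keepMax a y ≤ m
keepMax-≤ {a} {y} a≤m y≤m with a <ᵇ y
... | true  = y≤m
... | false = a≤m

≤-keepMax : ∀ a y → a ≤ keepMax a y
≤-keepMax a y with a <ᵇ y | <ᵇ-reflects-< a y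
... | true  | ofʸ a<y = <⇒≤ a<y
... | false | _       = ≤-refl

module _ (n i : ℕ) (B : Array) (s : ℕ) where

  private
    scanM : ℕ → ℕ → ℕ → ℕ
    scanM = scanOf M-unfolds n i B s

    scanM-≤ : ∀ {m} c r a → a ≤ m → (∀ {t} → r ≤ t → t ≤ c + r → S n i B s t ≤ m) → scanM c r a ≤ m
    scanM-≤ zero    r a a≤m S≤m = keepMax-≤ a≤m (S≤m ≤-refl ≤-refl)
    scanM-≤ (suc c) r a a≤m S≤m = keepMax-≤ a≤m (scanM-≤ c (suc r) _ (S≤m ≤-refl (m≤n+m r (suc c)))
      (λ r<t t≤ → S≤m (<⇒≤ r<t) (≤-trans t≤ (≤-reflexive (+-suc c r)))))

    ≤-scanM : ∀ c r a → a ≤ scanM c r a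
    ≤-scanM zero    r a = ≤-keepMax a (S n i B s r)
    ≤-scanM (suc c) r a = ≤-keepMax a (scanM c (suc r) (S n i B s r))

    M-zero : n ∸ i ≡ 0 → M n i B s ≡ S n i B s i
    M-zero n∸i≡0 with n ∸ i
    M-zero refl | .0 = refl

  M≡attained-bound : ∀ {m} → i ≤ n → S n i B s i ≡ m → (∀ {r} → i ≤ r → r ≤ n → S n i B s r ≤ m) →
    M n i B s ≡ m
  M≡attained-bound {m} i≤n Si≡m S≤m = byWidth (n ∸ i) refl
    where
    byWidth : ∀ c → n ∸ i ≡ c → M n i B s ≡ m
    byWidth zero    n∸i≡0   = trans (M-zero n∸i≡0) Si≡m
    byWidth (suc c) n∸i≡1+c = begin
      M n i B s                       ≡⟨ M-unfolds n i B s c (suc i) _ refl refl n∸i≡1+c ⟩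
      scanM c (suc i) (S n i B s i)   ≡⟨ ≤-antisym bounded (subst (_≤ scanM c (suc i) _) Si≡m (≤-scanM c (suc i) _)) ⟩
      m                               ∎
      where
      open ≡-Reasoning
      c+1+i≡n : c + suc i ≡ n
      c+1+i≡n = trans (+-suc c i) (trans (cong (_+ i) (sym n∸i≡1+c)) (m∸n+n≡m i≤n))
      bounded : scanM c (suc i) (S n i B s i) ≤ m
      bounded = scanM-≤ c (suc i) _ (≤-reflexive Si≡m)
        (λ i<t t≤ → S≤m (<⇒≤ i<t) (≤-trans t≤ (≤-reflexive c+1+i≡n)))

pathSum-rows : ∀ A a b d s → pathSum A a b (replicate d rowStep ++ s) ≡
  sum (applyUpTo (λ t → A a (b + t)) d) + pathSum A a (b + d) s
pathSum-rows A a b zero    s = cong (λ b′ → pathSum A a b′ s) (sym (+-identityʳ b))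
pathSum-rows A a b (suc d) s = begin
  A a b + pathSum A a (suc b) (replicate d rowStep ++ s)
    ≡⟨ cong (A a b +_) (pathSum-rows A a (suc b) d s) ⟩
  A a b + (sum (applyUpTo (λ t → A a (suc b + t)) d) + pathSum A a (suc b + d) s)
    ≡⟨ +-assoc (A a b) _ _ ⟨
  A a b + sum (applyUpTo (λ t → A a (suc b + t)) d) + pathSum A a (suc b + d) s
    ≡⟨ cong₂ _+_ (cong₂ _+_ (cong (A a) (sym (+-identityʳ b))) (sum-applyUpTo-cong d (λ _ → cong (A a) (sym (+-suc b _)))))
                 (cong (λ b′ → pathSum A a b′ s) (sym (+-suc b d))) ⟩
  A a (b + 0) + sum (applyUpTo (λ t → A a (b + suc t)) d) + pathSum A a (b + suc d) s
    ∎
  where open ≡-Reasoning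

endPt-rows : ∀ a b d s → endPt a b (replicate d rowStep ++ s) ≡ endPt a (b + d) s
endPt-rows a b zero    s = cong (λ b′ → endPt a b′ s) (sym (+-identityʳ b))
endPt-rows a b (suc d) s = trans (endPt-rows a (suc b) d s) (cong (λ b′ → endPt a b′ s) (sym (+-suc b d)))

-- A Dyck path for (n,i) is encoded by its rows r: column c+1 occupies rows r c to r (c+1).
module Paths (n i m : ℕ) where

  record RowPath (r : ℕ → ℕ) : Set where
    field
      start : r 0 ≡ i
      end   : r i ≡ n
      mono  : ∀ {c} → c < i → r c ≤ r (suc c)

  columnSum : Array → (ℕ → ℕ) → ℕ → ℕ
  columnSum X r c = Σ[ r c ⋯ r (suc c) ] (X (suc c))

  pathValue : Array → (ℕ → ℕ) → ℕ
  pathValue X r = sum (applyUpTo (columnSum X r) i)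

  Bounded : Array → Set
  Bounded X = ∀ {r} → RowPath r → pathValue X r ≤ m

  module _ {r : ℕ → ℕ} (ρ : RowPath r) where
    open RowPath ρ

    mono-≤ : ∀ {c c′} → c ≤ c′ → c′ ≤ i → r c ≤ r c′
    mono-≤ {c} {zero}   z≤n     _      = ≤-refl
    mono-≤ {c} {suc c′} c≤1+c′ 1+c′≤i with m≤n⇒m<n∨m≡n c≤1+c′
    ... | inj₁ c<1+c′ = ≤-trans (mono-≤ (s≤s⁻¹ c<1+c′) (<⇒≤ 1+c′≤i)) (mono 1+c′≤i)
    ... | inj₂ refl   = ≤-refl

    i≤row : ∀ {c} → c ≤ i → i ≤ r c
    i≤row c≤i = subst (_≤ r _) start (mono-≤ z≤n c≤i)

    row≤n : ∀ {c} → c ≤ i → r c ≤ n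
    row≤n c≤i = subst (r _ ≤_) end (mono-≤ c≤i ≤-refl)

  stepsFrom : (ℕ → ℕ) → ℕ → ℕ → List Step
  stepsFrom r c zero    = replicate (r (suc c) ∸ r c) rowStep ++ []
  stepsFrom r c (suc k) = replicate (r (suc c) ∸ r c) rowStep ++ colStep ∷ stepsFrom r (suc c) k

  pathSum-column : ∀ (X : Array) (r : ℕ → ℕ) c s → r c ≤ r (suc c) →
    pathSum X (suc c) (r c) (replicate (r (suc c) ∸ r c) rowStep ++ s) ≡
    sum (applyUpTo (λ t → X (suc c) (r c + t)) (r (suc c) ∸ r c)) + pathSum X (suc c) (r (suc c)) s
  pathSum-column X r c s rc≤rc′ = trans (pathSum-rows X (suc c) (r c) (r (suc c) ∸ r c) s)
    (cong (λ b → sum (applyUpTo (λ t → X (suc c) (r c + t)) (r (suc c) ∸ r c)) + pathSum X (suc c) b s)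
          (m+[n∸m]≡n rc≤rc′))

  module _ (X : Array) {r : ℕ → ℕ} (ρ : RowPath r) where
    open RowPath ρ

    stepsFrom-sum : ∀ c k → c + k < i →
      pathSum X (suc c) (r c) (stepsFrom r c k) ≡ sum (applyUpTo (λ j → columnSum X r (c + j)) (suc k))
    stepsFrom-sum c zero c+0<i rewrite +-identityʳ c = begin
      pathSum X (suc c) (r c) (replicate (r (suc c) ∸ r c) rowStep ++ [])
        ≡⟨ pathSum-column X r c [] (mono c+0<i) ⟩
      sum (applyUpTo (λ t → X (suc c) (r c + t)) (r (suc c) ∸ r c)) + X (suc c) (r (suc c))
        ≡⟨ Σ-snoc (X (suc c)) (mono c+0<i) ⟨
      columnSum X r c
        ≡⟨ +-identityʳ _ ⟨
      columnSum X r c + 0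
        ∎
      where open ≡-Reasoning
    stepsFrom-sum c (suc k) c+1+k<i = begin
      pathSum X (suc c) (r c) (replicate (r (suc c) ∸ r c) rowStep ++ colStep ∷ rest)
        ≡⟨ pathSum-column X r c (colStep ∷ rest) (mono c<i) ⟩
      before + (X (suc c) (r (suc c)) + pathSum X (suc (suc c)) (r (suc c)) rest)
        ≡⟨ +-assoc before _ _ ⟨
      before + X (suc c) (r (suc c)) + pathSum X (suc (suc c)) (r (suc c)) rest
        ≡⟨ cong₂ _+_ (Σ-snoc (X (suc c)) (mono c<i)) (sym (stepsFrom-sum (suc c) k (subst (_< i) (+-suc c k) c+1+k<i))) ⟨
      columnSum X r c + sum (applyUpTo (λ j → columnSum X r (suc c + j)) (suc k))
        ≡⟨ cong₂ _+_ (cong (columnSum X r) (+-identityʳ c))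
                     (sum-applyUpTo-cong (suc k) (λ {j} _ → cong (columnSum X r) (+-suc c j))) ⟨
      columnSum X r (c + 0) + sum (applyUpTo (λ j → columnSum X r (c + suc j)) (suc k))
        ∎
      where
      open ≡-Reasoning
      rest = stepsFrom r (suc c) k
      before = sum (applyUpTo (λ t → X (suc c) (r c + t)) (r (suc c) ∸ r c))
      c<i : c < i
      c<i = ≤-<-trans (m≤m+n c (suc k)) c+1+k<i

    stepsFrom-end : ∀ c k → c + k < i → endPt (suc c) (r c) (stepsFrom r c k) ≡ (suc (c + k) , r (suc (c + k)))
    stepsFrom-end c zero c+0<i rewrite +-identityʳ c =
      trans (endPt-rows (suc c) (r c) (r (suc c) ∸ r c) []) (cong (suc c ,_) (m+[n∸m]≡n (mono c+0<i)))
    stepsFrom-end c (suc k) c+1+k<i = begin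
      endPt (suc c) (r c) (replicate (r (suc c) ∸ r c) rowStep ++ colStep ∷ rest)
        ≡⟨ endPt-rows (suc c) (r c) (r (suc c) ∸ r c) (colStep ∷ rest) ⟩
      endPt (suc (suc c)) (r c + (r (suc c) ∸ r c)) rest
        ≡⟨ cong (λ b → endPt (suc (suc c)) b rest) (m+[n∸m]≡n (mono c<i)) ⟩
      endPt (suc (suc c)) (r (suc c)) rest
        ≡⟨ stepsFrom-end (suc c) k (subst (_< i) (+-suc c k) c+1+k<i) ⟩
      (suc (suc c + k) , r (suc (suc c + k)))
        ≡⟨ cong (λ c′ → suc c′ , r (suc c′)) (+-suc c k) ⟨
      (suc (c + suc k) , r (suc (c + suc k)))
        ∎
      where
      open ≡-Reasoning
      rest = stepsFrom r (suc c) k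
      c<i : c < i
      c<i = ≤-<-trans (m≤m+n c (suc k)) c+1+k<i

  InB⇒Bounded : ∀ {X} → 1 ≤ i → InB n i m X → Bounded X
  InB⇒Bounded {X} 1≤i inB {r} ρ = subst (_≤ m) value (InB.dyck inB s dyck)
    where
    open RowPath ρ
    i₁ = i ∸ 1
    1+i₁≡i : suc i₁ ≡ i
    1+i₁≡i = m+[n∸m]≡n 1≤i
    i₁<i : 0 + i₁ < i
    i₁<i = subst (i₁ <_) 1+i₁≡i ≤-refl
    s = stepsFrom r 0 i₁
    value : pathSum X 1 i s ≡ pathValue X r
    value = begin
      pathSum X 1 i s                             ≡⟨ cong (λ b → pathSum X 1 b s) start ⟨
      pathSum X 1 (r 0) s                         ≡⟨ stepsFrom-sum X ρ 0 i₁ i₁<i ⟩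
      sum (applyUpTo (columnSum X r) (suc i₁))    ≡⟨ cong (sum ∘ applyUpTo (columnSum X r)) 1+i₁≡i ⟩
      pathValue X r                               ∎
      where open ≡-Reasoning
    dyck : endPt 1 i s ≡ (i , n)
    dyck = begin
      endPt 1 i s                   ≡⟨ cong (λ b → endPt 1 b s) start ⟨
      endPt 1 (r 0) s               ≡⟨ stepsFrom-end X ρ 0 i₁ i₁<i ⟩
      (suc i₁ , r (suc i₁))         ≡⟨ cong (λ c → c , r c) 1+i₁≡i ⟩
      (i , r i)                     ≡⟨ cong (i ,_) end ⟩
      (i , n)                       ∎
      where open ≡-Reasoning

  Bounded-mono : ∀ {X Y} → (∀ p q → X p q ≤ Y p q) → Bounded Y → Bounded X
  Bounded-mono {X} {Y} X≤Y bounded {r} ρ = ≤-trans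
    (sum-applyUpTo-mono i (λ {c} _ → Σ-mono (r c) (r (suc c)) (X≤Y (suc c))))
    (bounded ρ)

  pathValue-≤-twoColumns : ∀ {X X′ r r′} d → suc d < i →
    (∀ {c j} → c ≢ suc d → c ≢ suc (suc d) → X′ c j ≡ X c j) → (∀ {c} → c ≢ suc d → r′ c ≡ r c) →
    twoColumnSum X′ (suc d) (r d) (r (suc d)) (r (suc (suc d))) ≤
      twoColumnSum X (suc d) (r′ d) (r′ (suc d)) (r′ (suc (suc d))) →
    pathValue X′ r ≤ pathValue X r′
  pathValue-≤-twoColumns {X} {X′} {r} {r′} d ℓ<i elsewhere agree = sum-applyUpTo-mono-adjacent d ℓ<i same
    where
    same : ∀ {c} → c < i → c ≢ d → c ≢ suc d → columnSum X′ r c ≡ columnSum X r′ c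
    same {c} _ c≢d c≢1+d = trans
      (Σ-cong (r c) (r (suc c)) (λ {j} _ _ → elsewhere {suc c} {j} (c≢d ∘ suc-injective) (c≢1+d ∘ suc-injective)))
      (cong₂ (λ a b → Σ[ a ⋯ b ] (X (suc c))) (sym (agree c≢1+d)) (sym (agree (c≢d ∘ suc-injective))))

  hookPath : ℕ → ℕ → ℕ → ℕ
  hookPath ℓ t c with <-cmp c ℓ
  ... | tri< _ _ _ = i
  ... | tri≈ _ _ _ = t
  ... | tri> _ _ _ = n

  hookPath-< : ∀ ℓ t {c} → c < ℓ → hookPath ℓ t c ≡ i
  hookPath-< ℓ t {c} c<ℓ with <-cmp c ℓ
  ... | tri< _ _ _    = refl
  ... | tri≈ c≮ℓ _ _  = ⊥-elim (c≮ℓ c<ℓ)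
  ... | tri> c≮ℓ _ _  = ⊥-elim (c≮ℓ c<ℓ)

  hookPath-≡ : ∀ ℓ t → hookPath ℓ t ℓ ≡ t
  hookPath-≡ ℓ t with <-cmp ℓ ℓ
  ... | tri< _ ℓ≢ℓ _  = ⊥-elim (ℓ≢ℓ refl)
  ... | tri≈ _ _ _    = refl
  ... | tri> _ ℓ≢ℓ _  = ⊥-elim (ℓ≢ℓ refl)

  hookPath-> : ∀ ℓ t {c} → ℓ < c → hookPath ℓ t c ≡ n
  hookPath-> ℓ t {c} ℓ<c with <-cmp c ℓ
  ... | tri< _ _ c≯ℓ  = ⊥-elim (c≯ℓ ℓ<c)
  ... | tri≈ _ _ c≯ℓ  = ⊥-elim (c≯ℓ ℓ<c)
  ... | tri> _ _ _    = refl

  hookPath-rowPath : ∀ {ℓ t} → 1 ≤ ℓ → ℓ ≤ i → i ≤ t → t ≤ n → (ℓ ≡ i → t ≡ n) → RowPath (hookPath ℓ t)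
  hookPath-rowPath {ℓ} {t} 1≤ℓ ℓ≤i i≤t t≤n ℓ≡i⇒t≡n = record
    { start = hookPath-< ℓ t 1≤ℓ
    ; end   = [ hookPath-> ℓ t
              , (λ ℓ≡i → trans (cong (hookPath ℓ t) (sym ℓ≡i)) (trans (hookPath-≡ ℓ t) (ℓ≡i⇒t≡n ℓ≡i))) ]
                (m≤n⇒m<n∨m≡n ℓ≤i)
    ; mono  = mono
    }
    where
    i≤hookPath : ∀ c → i ≤ hookPath ℓ t c
    i≤hookPath c with <-cmp c ℓ
    ... | tri< _ _ _ = ≤-refl
    ... | tri≈ _ _ _ = i≤t
    ... | tri> _ _ _ = ≤-trans i≤t t≤n
    mono : ∀ {c} → c < i → hookPath ℓ t c ≤ hookPath ℓ t (suc c)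
    mono {c} _ with <-cmp c ℓ
    ... | tri< _ _ _    = i≤hookPath (suc c)
    ... | tri≈ _ refl _ = subst (t ≤_) (sym (hookPath-> ℓ t ≤-refl)) t≤n
    ... | tri> _ _ ℓ<c  = ≤-reflexive (sym (hookPath-> ℓ t (m<n⇒m<1+n ℓ<c)))

  Bounded⇒S≤m : ∀ {X} → Bounded X → ∀ {d t} → suc d < i → i ≤ t → t ≤ n → S n i X (suc d) t ≤ m
  Bounded⇒S≤m {X} bounded {d} {t} ℓ<i i≤t t≤n = begin
    S n i X (suc d) t                         ≡⟨ cong₂ _+_ columnℓ columnℓ+1 ⟨
    columnSum X r d + columnSum X r (suc d)   ≤⟨ adjacent≤sum-applyUpTo (columnSum X r) d ℓ<i ⟩
    pathValue X r                             ≤⟨ bounded ρ ⟩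
    m                                         ∎
    where
    open ≤-Reasoning
    r = hookPath (suc d) t
    ρ = hookPath-rowPath (s≤s z≤n) (<⇒≤ ℓ<i) i≤t t≤n (λ ℓ≡i → ⊥-elim (<⇒≢ ℓ<i ℓ≡i))
    columnℓ : columnSum X r d ≡ Σ[ i ⋯ t ] (X (suc d))
    columnℓ = cong₂ (λ a b → Σ[ a ⋯ b ] (X (suc d))) (hookPath-< (suc d) t ≤-refl) (hookPath-≡ (suc d) t)
    columnℓ+1 : columnSum X r (suc d) ≡ Σ[ t ⋯ n ] (X (suc (suc d)))
    columnℓ+1 = cong₂ (λ a b → Σ[ a ⋯ b ] (X (suc (suc d)))) (hookPath-≡ (suc d) t) (hookPath-> (suc d) t ≤-refl)

  pathValue-through-diagonal : ∀ X {r} → 1 ≤ i → RowPath r → r (i ∸ 1) ≡ i → pathValue X r ≡ hookSum n i X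
  pathValue-through-diagonal X {r} 1≤i ρ r[i₁]≡i = begin
    pathValue X r                                              ≡⟨ cong (sum ∘ applyUpTo (columnSum X r)) 1+i₁≡i ⟨
    sum (applyUpTo (columnSum X r) (suc i₁))                   ≡⟨ sum-applyUpTo-suc (columnSum X r) i₁ ⟩
    sum (applyUpTo (columnSum X r) i₁) + columnSum X r i₁      ≡⟨ cong₂ _+_ (sum-applyUpTo-cong i₁ rowPart) columnPart ⟩
    sum (applyUpTo (λ c → X (suc c) i) i₁) + Σ[ i ⋯ n ] (X i)  ≡⟨ cong (_+ Σ[ i ⋯ n ] (X i)) (Σ-as-sum (λ j → X j i) 1 i₁) ⟨
    hookSum n i X                                              ∎
    where
    open ≡-Reasoning
    open RowPath ρ
    i₁ = i ∸ 1
    1+i₁≡i : suc i₁ ≡ i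
    1+i₁≡i = m+[n∸m]≡n 1≤i
    onDiagonal : ∀ {c} → c ≤ i₁ → r c ≡ i
    onDiagonal c≤i₁ = ≤-antisym (subst (r _ ≤_) r[i₁]≡i (mono-≤ ρ c≤i₁ (subst (i₁ ≤_) 1+i₁≡i (n≤1+n i₁))))
                                (i≤row ρ (≤-trans c≤i₁ (subst (i₁ ≤_) 1+i₁≡i (n≤1+n i₁))))
    rowPart : ∀ {c} → c < i₁ → columnSum X r c ≡ X (suc c) i
    rowPart c<i₁ = trans (cong₂ (λ a b → Σ[ a ⋯ b ] (X (suc _))) (onDiagonal (<⇒≤ c<i₁)) (onDiagonal c<i₁))
                         (Σ-singleton (X (suc _)) i)
    columnPart : columnSum X r i₁ ≡ Σ[ i ⋯ n ] (X i)
    columnPart = trans (cong₂ (λ a b → Σ[ a ⋯ b ] (X (suc i₁))) r[i₁]≡i (trans (cong r 1+i₁≡i) end))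
                       (cong (λ c → Σ[ i ⋯ n ] (X c)) 1+i₁≡i)

  Bounded⇒hookSum≤m : ∀ {X} → 1 ≤ i → i ≤ n → Bounded X → hookSum n i X ≤ m
  Bounded⇒hookSum≤m {X} 1≤i i≤n bounded =
    subst (_≤ m) (pathValue-through-diagonal X 1≤i ρ (hookPath-< i n (∸-monoʳ-< z<s 1≤i)))
      (bounded ρ)
    where
    ρ = hookPath-rowPath 1≤i ≤-refl i≤n ≤-refl (λ _ → refl)

  bend : (ℕ → ℕ) → ℕ → ℕ → ℕ → ℕ
  bend r ℓ q c with c ≟ ℓ
  ... | yes _ = q
  ... | no  _ = r c

  bend-hit : ∀ r ℓ q → bend r ℓ q ℓ ≡ q
  bend-hit r ℓ q with ℓ ≟ ℓ
  ... | yes _   = refl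
  ... | no ℓ≢ℓ  = ⊥-elim (ℓ≢ℓ refl)

  bend-miss : ∀ r ℓ q {c} → c ≢ ℓ → bend r ℓ q c ≡ r c
  bend-miss r ℓ q {c} c≢ℓ with c ≟ ℓ
  ... | yes c≡ℓ = ⊥-elim (c≢ℓ c≡ℓ)
  ... | no  _   = refl

  bend-rowPath : ∀ {r d q} → RowPath r → suc d < i → r d ≤ q → q ≤ r (suc (suc d)) → RowPath (bend r (suc d) q)
  bend-rowPath {r} {d} {q} ρ ℓ<i r[d]≤q q≤r[ℓ+1] = record
    { start = trans (bend-miss r (suc d) q (λ ())) start
    ; end   = trans (bend-miss r (suc d) q (>⇒≢ ℓ<i)) end
    ; mono  = mono′
    }
    where
    open RowPath ρ
    mono′ : ∀ {c} → c < i → bend r (suc d) q c ≤ bend r (suc d) q (suc c)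
    mono′ {c} c<i with c ≟ suc d | suc c ≟ suc d
    ... | yes refl | yes 2+d≡1+d = ⊥-elim (1+n≢n 2+d≡1+d)
    ... | yes refl | no  _       = q≤r[ℓ+1]
    ... | no  _    | yes refl    = r[d]≤q
    ... | no  _    | no  _       = mono c<i

module MoveLeft (n i m : ℕ) (X : Array) (d q : ℕ) (occupied : 1 ≤ X (suc (suc d)) q) where
  open Paths n i m

  ℓ : ℕ
  ℓ = suc d

  X′ : Array
  X′ = moveLeft ℓ q X

  private
    ℓ≢1+ℓ : ℓ ≢ suc ℓ
    ℓ≢1+ℓ = <⇒≢ (n<1+n ℓ)

    X₁ : Array
    X₁ = modify ℓ q suc X

    outer-miss : ∀ {c j} → c ≢ suc ℓ ⊎ j ≢ q → X′ c j ≡ X₁ c j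
    outer-miss = modify-miss (suc ℓ) q (λ x → x ∸ 1) X₁

    inner-miss : ∀ {c j} → c ≢ ℓ ⊎ j ≢ q → X₁ c j ≡ X c j
    inner-miss = modify-miss ℓ q suc X

    left-hit : X′ ℓ q ≡ suc (X ℓ q)
    left-hit = trans (outer-miss (inj₁ ℓ≢1+ℓ)) (modify-hit ℓ q suc X)

    left-miss : ∀ {j} → j ≢ q → X′ ℓ j ≡ X ℓ j
    left-miss j≢q = trans (outer-miss {ℓ} (inj₂ j≢q)) (inner-miss {ℓ} (inj₂ j≢q))

    right-hit : X (suc ℓ) q ≡ suc (X′ (suc ℓ) q)
    right-hit = begin
      X (suc ℓ) q             ≡⟨ m∸n+n≡m occupied ⟨
      X (suc ℓ) q ∸ 1 + 1     ≡⟨ +-comm _ 1 ⟩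
      suc (X (suc ℓ) q ∸ 1)   ≡⟨ cong (λ x → suc (x ∸ 1)) (inner-miss (inj₁ 1+n≢n)) ⟨
      suc (X₁ (suc ℓ) q ∸ 1)  ≡⟨ cong suc (modify-hit (suc ℓ) q (λ x → x ∸ 1) X₁) ⟨
      suc (X′ (suc ℓ) q)      ∎
      where open ≡-Reasoning

    right-miss : ∀ {j} → j ≢ q → X′ (suc ℓ) j ≡ X (suc ℓ) j
    right-miss j≢q = trans (outer-miss {suc ℓ} (inj₂ j≢q)) (inner-miss {suc ℓ} (inj₂ j≢q))

  elsewhere : ∀ {c j} → c ≢ ℓ → c ≢ suc ℓ → X′ c j ≡ X c j
  elsewhere c≢ℓ c≢1+ℓ = trans (outer-miss (inj₁ c≢1+ℓ)) (inner-miss (inj₁ c≢ℓ))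

  Σ-left-in : ∀ {a b} → a ≤ q → q ≤ b → Σ[ a ⋯ b ] (X′ ℓ) ≡ suc (Σ[ a ⋯ b ] (X ℓ))
  Σ-left-in = Σ-incr q left-miss left-hit

  private
    missesRange : ∀ {a b j} → q < a ⊎ b < q → a ≤ j → j ≤ b → j ≢ q
    missesRange (inj₁ q<a) a≤j _ refl = <⇒≱ q<a a≤j
    missesRange (inj₂ b<q) _ j≤b refl = <⇒≱ b<q j≤b

    Σ-left-out : ∀ {a b} → q < a ⊎ b < q → Σ[ a ⋯ b ] (X′ ℓ) ≡ Σ[ a ⋯ b ] (X ℓ)
    Σ-left-out {a} {b} out = Σ-cong a b (λ a≤j j≤b → left-miss (missesRange out a≤j j≤b))

    Σ-right-in : ∀ {a b} → a ≤ q → q ≤ b → Σ[ a ⋯ b ] (X (suc ℓ)) ≡ suc (Σ[ a ⋯ b ] (X′ (suc ℓ)))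
    Σ-right-in = Σ-incr q (sym ∘ right-miss) right-hit

    Σ-right-out : ∀ {a b} → q < a ⊎ b < q → Σ[ a ⋯ b ] (X′ (suc ℓ)) ≡ Σ[ a ⋯ b ] (X (suc ℓ))
    Σ-right-out {a} {b} out = Σ-cong a b (λ a≤j j≤b → right-miss (missesRange out a≤j j≤b))

    Σ-right-≤ : ∀ a b → Σ[ a ⋯ b ] (X′ (suc ℓ)) ≤ Σ[ a ⋯ b ] (X (suc ℓ))
    Σ-right-≤ a b = Σ-mono a b pointwise
      where
      pointwise : ∀ j → X′ (suc ℓ) j ≤ X (suc ℓ) j
      pointwise j = byCase (j ≟ q)
        where
        byCase : Dec (j ≡ q) → X′ (suc ℓ) j ≤ X (suc ℓ) j
        byCase (yes j≡q) = subst (λ j → X′ (suc ℓ) j ≤ X (suc ℓ) j) (sym j≡q)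
                                 (≤-trans (n≤1+n _) (≤-reflexive (sym right-hit)))
        byCase (no  j≢q) = ≤-reflexive (right-miss j≢q)

  twoColumnSum-avoid : ∀ {s t u} → q < s ⊎ t < q → twoColumnSum X′ ℓ s t u ≤ twoColumnSum X ℓ s t u
  twoColumnSum-avoid {s} {t} {u} out = +-mono-≤ (≤-reflexive (Σ-left-out out)) (Σ-right-≤ t u)

  twoColumnSum-at : ∀ {s u} → s ≤ q → q ≤ u → twoColumnSum X′ ℓ s q u ≡ twoColumnSum X ℓ s q u
  twoColumnSum-at {s} {u} s≤q q≤u = begin
    Σ[ s ⋯ q ] (X′ ℓ) + Σ[ q ⋯ u ] (X′ (suc ℓ))         ≡⟨ cong (_+ Σ[ q ⋯ u ] (X′ (suc ℓ))) (Σ-left-in s≤q ≤-refl) ⟩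
    suc (Σ[ s ⋯ q ] (X ℓ)) + Σ[ q ⋯ u ] (X′ (suc ℓ))   ≡⟨ +-suc _ _ ⟨
    Σ[ s ⋯ q ] (X ℓ) + suc (Σ[ q ⋯ u ] (X′ (suc ℓ)))   ≡⟨ cong (Σ[ s ⋯ q ] (X ℓ) +_) (Σ-right-in ≤-refl q≤u) ⟨
    Σ[ s ⋯ q ] (X ℓ) + Σ[ q ⋯ u ] (X (suc ℓ))           ∎
    where open ≡-Reasoning

  twoColumnSum-above : ∀ {s t u} → s ≤ q → q < t → twoColumnSum X′ ℓ s t u ≡ suc (twoColumnSum X ℓ s t u)
  twoColumnSum-above s≤q q<t = cong₂ _+_ (Σ-left-in s≤q (<⇒≤ q<t)) (Σ-right-out (inj₁ q<t))

  module _ (q-lastMax : IsLastArgmax (S n i X ℓ) i n q) where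
    open IsLastArgmax q-lastMax

    S-moveLeft-≤ : ∀ {t} → i ≤ t → t ≤ n → S n i X′ ℓ t ≤ S n i X ℓ q
    S-moveLeft-≤ {t} i≤t t≤n with <-cmp t q
    ... | tri< t<q _ _  = ≤-trans (twoColumnSum-avoid {i} {t} {n} (inj₂ t<q)) (maximal i≤t t≤n)
    ... | tri≈ _ refl _ = ≤-reflexive (twoColumnSum-at {i} {n} i≤t t≤n)
    ... | tri> _ _ q<t  = ≤-trans (≤-reflexive (twoColumnSum-above {i} {t} {n} lower q<t)) (last q<t t≤n)

    moveLeft-Bounded : suc d < i → Bounded X → Bounded X′
    moveLeft-Bounded ℓ<i bounded {r} ρ = byTurn (q <? s) (<-cmp q t)
      where
      open RowPath ρ
      s = r d
      t = r ℓ
      u = r (suc ℓ)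
      t≤u : t ≤ u
      t≤u = mono ℓ<i
      u≤n : u ≤ n
      u≤n = row≤n ρ ℓ<i

      via : ∀ {r′} → RowPath r′ → (∀ {c} → c ≢ ℓ → r′ c ≡ r c) →
        twoColumnSum X′ ℓ s t u ≤ twoColumnSum X ℓ (r′ d) (r′ ℓ) (r′ (suc ℓ)) → pathValue X′ r ≤ m
      via ρ′ agree turn≤ = ≤-trans (pathValue-≤-twoColumns {X} {X′} d ℓ<i elsewhere agree turn≤) (bounded ρ′)

      bent : twoColumnSum X ℓ (bend r ℓ q d) (bend r ℓ q ℓ) (bend r ℓ q (suc ℓ)) ≡ twoColumnSum X ℓ s q u
      bent = trans
        (cong₂ (λ a c → twoColumnSum X ℓ a (bend r ℓ q ℓ) c) (bend-miss r ℓ q (<⇒≢ (n<1+n d))) (bend-miss r ℓ q 1+n≢n))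
        (cong (λ b → twoColumnSum X ℓ s b u) (bend-hit r ℓ q))

      byTurn : Dec (q < s) → Tri (q < t) (q ≡ t) (t < q) → pathValue X′ r ≤ m
      byTurn (yes q<s) _              = via ρ (λ _ → refl) (twoColumnSum-avoid {s} {t} {u} (inj₁ q<s))
      byTurn (no _)    (tri> _ _ t<q) = via ρ (λ _ → refl) (twoColumnSum-avoid {s} {t} {u} (inj₂ t<q))
      byTurn (no q≮s)  (tri≈ _ q≡t _) = via ρ (λ _ → refl)
        (≤-reflexive (subst (λ t → twoColumnSum X′ ℓ s t u ≡ twoColumnSum X ℓ s t u) q≡t
                            (twoColumnSum-at {s} {u} (≮⇒≥ q≮s) (subst (_≤ u) (sym q≡t) t≤u))))
      byTurn (no q≮s)  (tri< q<t _ _) = via (bend-rowPath ρ ℓ<i (≮⇒≥ q≮s) (≤-trans (<⇒≤ q<t) t≤u)) (bend-miss r ℓ q) (begin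
        twoColumnSum X′ ℓ s t u        ≡⟨ twoColumnSum-above {s} {t} {u} (≮⇒≥ q≮s) q<t ⟩
        suc (twoColumnSum X ℓ s t u)   ≤⟨ corner-exchange-< X ℓ lower (≮⇒≥ q≮s) (<⇒≤ q<t) t≤u u≤n
                                            (last q<t (≤-trans t≤u u≤n)) ⟩
        twoColumnSum X ℓ s q u         ≡⟨ bent ⟨
        twoColumnSum X ℓ (bend r ℓ q d) (bend r ℓ q ℓ) (bend r ℓ q (suc ℓ)) ∎)
        where open ≤-Reasoning

module Diagonal (n i m : ℕ) (1≤i : 1 ≤ i) (i≤n : i ≤ n) (X : Array) where
  open Paths n i m

  X′ : Array
  X′ = modify i i suc X

  off-diagonal : ∀ {c j} → c ≢ i ⊎ j ≢ i → X′ c j ≡ X c j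
  off-diagonal = modify-miss i i suc X

  hookSum-bump : hookSum n i X′ ≡ suc (hookSum n i X)
  hookSum-bump = trans (cong₂ _+_ rowPart columnPart) (+-suc _ _)
    where
    rowPart : Σ[ 1 ⋯ i ∸ 1 ] (λ j → X′ j i) ≡ Σ[ 1 ⋯ i ∸ 1 ] (λ j → X j i)
    rowPart = Σ-cong 1 (i ∸ 1) (λ {j} _ j≤i₁ → off-diagonal {j} {i} (inj₁ (<⇒≢ (≤-<-trans j≤i₁ (∸-monoʳ-< z<s 1≤i)))))
    columnPart : Σ[ i ⋯ n ] (X′ i) ≡ suc (Σ[ i ⋯ n ] (X i))
    columnPart = Σ-incr i (λ {j} j≢i → off-diagonal {i} {j} (inj₂ j≢i)) (modify-hit i i suc X) ≤-refl i≤n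

  bumpDiagonal-Bounded : Bounded X → hookSum n i X < m → Bounded X′
  bumpDiagonal-Bounded bounded hook<m {r} ρ with r (i ∸ 1) ≟ i
  ... | yes through = begin
    pathValue X′ r         ≡⟨ pathValue-through-diagonal X′ 1≤i ρ through ⟩
    hookSum n i X′         ≡⟨ hookSum-bump ⟩
    suc (hookSum n i X)    ≤⟨ hook<m ⟩
    m                      ∎
    where open ≤-Reasoning
  ... | no avoids = subst (_≤ m) (sum-applyUpTo-cong i unchanged) (bounded ρ)
    where
    open RowPath ρ
    unchanged : ∀ {c} → c < i → columnSum X r c ≡ columnSum X′ r c
    unchanged {c} c<i = byColumn (suc c ≟ i)
      where
      byColumn : Dec (suc c ≡ i) → columnSum X r c ≡ columnSum X′ r c
      byColumn (no 1+c≢i) = Σ-cong (r c) (r (suc c)) (λ {j} _ _ → sym (off-diagonal {suc c} {j} (inj₁ 1+c≢i)))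
      byColumn (yes 1+c≡i) = Σ-cong (r c) (r (suc c))
        (λ {j} r[c]≤j _ → sym (off-diagonal {suc c} {j} (inj₂ (>⇒≢ (<-≤-trans i<r[c] r[c]≤j)))))
        where
        i<r[c] : i < r c
        i<r[c] = ≤∧≢⇒< (i≤row ρ (<⇒≤ c<i))
          (λ i≡r[c] → avoids (trans (cong (λ c → r (c ∸ 1)) (sym 1+c≡i)) (sym i≡r[c])))

module Stages (n i m : ℕ) (i≤n : i ≤ n) where
  open Paths n i m

  Saturated : ℕ → Array → Set
  Saturated ℓ X = Bounded X × RowZeroBefore X i ℓ × Σ[ i ⋯ n ] (X ℓ) ≡ m

  module _ (1≤i : 1 ≤ i) where

    private
      Invariant : ℕ → Array → Set
      Invariant k X = Bounded X × RowZeroBefore X i i × k + hookSum n i X ≡ m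

      step : ∀ k X → Invariant (suc k) X → ∃ λ Y → f n i m i X ≡ just Y × Invariant k Y
      step k X (bounded , rowZero , 1+k+hook≡m) =
        X′ , f-diag n i m X φ≡1+k , bumpDiagonal-Bounded bounded hook<m , rowZero′ , k+hook′≡m
        where
        open Diagonal n i m 1≤i i≤n X
        φ≡1+k : φ n i m i X ≡ suc k
        φ≡1+k = trans (φ-diag n i m X) (trans (cong (_∸ hookSum n i X) (sym 1+k+hook≡m)) (m+n∸n≡m (suc k) (hookSum n i X)))
        hook<m : hookSum n i X < m
        hook<m = subst (hookSum n i X <_) 1+k+hook≡m (s≤s (m≤n+m _ k))
        rowZero′ : RowZeroBefore X′ i i
        rowZero′ c<i = trans (off-diagonal (inj₁ (<⇒≢ c<i))) (rowZero c<i)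
        k+hook′≡m : k + hookSum n i X′ ≡ m
        k+hook′≡m = trans (cong (k +_) hookSum-bump) (trans (+-suc k _) 1+k+hook≡m)

    diagonalStage : ∀ {R} → Bounded R → RowZeroBefore R i i → ∃ λ Y → fφ n i m i R ≡ just Y × Saturated i Y
    diagonalStage {R} bounded rowZero
      with iterM-countdown (f n i m i) Invariant step (φ n i m i R) R (bounded , rowZero , φ+hook≡m)
      where
      φ+hook≡m : φ n i m i R + hookSum n i R ≡ m
      φ+hook≡m = trans (cong (_+ hookSum n i R) (φ-diag n i m R)) (m∸n+n≡m (Bounded⇒hookSum≤m {R} 1≤i i≤n bounded))
    ... | Y , fφR≡Y , (boundedY , rowZeroY , hook≡m) = Y , fφR≡Y , boundedY , rowZeroY , column≡m
      where
      column≡m : Σ[ i ⋯ n ] (Y i) ≡ m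
      column≡m = trans (cong (_+ Σ[ i ⋯ n ] (Y i)) (sym rowPart)) hook≡m
        where
        rowPart : Σ[ 1 ⋯ i ∸ 1 ] (λ j → Y j i) ≡ 0
        rowPart = Σ-zero 1 (i ∸ 1) (λ _ j≤i₁ → rowZeroY (≤-<-trans j≤i₁ (∸-monoʳ-< z<s 1≤i)))

  module _ {d : ℕ} (ℓ<i : suc d < i) where

    private
      ℓ : ℕ
      ℓ = suc d

      p₋ : Array → ℕ
      p₋ X = pMinus n i ℓ X

      p₋-lastMax : ∀ X → IsLastArgmax (S n i X ℓ) i n (p₋ X)
      p₋-lastMax X = lastArgmax-correct (S n i X ℓ) i (n ∸ i) (m+[n∸m]≡n i≤n)

      φ+column : ∀ X → φ n i m ℓ X + Σ[ i ⋯ n ] (X ℓ) ≡ S n i X ℓ (p₋ X)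
      φ+column X = begin
        φ n i m ℓ X + Σ[ i ⋯ n ] (X ℓ)   ≡⟨ cong₂ _+_ (φ-off n i m X (<⇒≢ ℓ<i)) split ⟩
        (G ∸ F) + (A + F)                ≡⟨ cong ((G ∸ F) +_) (+-comm A F) ⟩
        (G ∸ F) + (F + A)                ≡⟨ +-assoc (G ∸ F) F A ⟨
        (G ∸ F) + F + A                  ≡⟨ cong (_+ A) (m∸n+n≡m F≤G) ⟩
        G + A                            ≡⟨ +-comm G A ⟩
        A + G                            ∎
        where
        open ≡-Reasoning
        open IsLastArgmax (p₋-lastMax X)
        q = p₋ X
        A = Σ[ i ⋯ q ] (X ℓ)
        F = Σ[ suc q ⋯ n ] (X ℓ)
        G = Σ[ q ⋯ n ] (X (suc ℓ))
        split : Σ[ i ⋯ n ] (X ℓ) ≡ A + F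
        split = Σ-split (X ℓ) q (m≤n⇒m≤1+n lower) upper
        F≤G : F ≤ G
        F≤G = +-cancelˡ-≤ A F G (≤-trans (≤-reflexive (sym split)) (≤-trans (m≤m+n _ _) (maximal i≤n ≤-refl)))

      occupied : ∀ {k} X → φ n i m ℓ X ≡ suc k → 1 ≤ X (suc ℓ) (p₋ X)
      -- For q < n, S (suc q) < S q says a_{ℓ,q+1} < a_{ℓ+1,q}; for q = n, φ_ℓ is a_{ℓ+1,n}.
      occupied {k} X φ≡1+k with m≤n⇒m<n∨m≡n (IsLastArgmax.upper (p₋-lastMax X))
      ... | inj₁ q<n = ≤-trans (s≤s z≤n) (+-cancelˡ-< (S n i X ℓ q) _ _ (begin-strict
        S n i X ℓ q + X ℓ (suc q)             ≡⟨ twoColumnSum-step X ℓ (m≤n⇒m≤1+n lower) q<n ⟨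
        S n i X ℓ (suc q) + X (suc ℓ) q       <⟨ +-monoˡ-< (X (suc ℓ) q) (last (n<1+n q) q<n) ⟩
        S n i X ℓ q + X (suc ℓ) q             ∎))
        where
        open ≤-Reasoning
        open IsLastArgmax (p₋-lastMax X)
        q = p₋ X
      ... | inj₂ q≡n = subst (1 ≤_) (begin
        suc k                                                   ≡⟨ φ≡1+k ⟨
        φ n i m ℓ X                                             ≡⟨ φ-off n i m X (<⇒≢ ℓ<i) ⟩
        Σ[ p₋ X ⋯ n ] (X (suc ℓ)) ∸ Σ[ suc (p₋ X) ⋯ n ] (X ℓ)   ≡⟨ cong (λ q → Σ[ q ⋯ n ] (X (suc ℓ)) ∸ Σ[ suc q ⋯ n ] (X ℓ)) q≡n ⟩
        Σ[ n ⋯ n ] (X (suc ℓ)) ∸ Σ[ suc n ⋯ n ] (X ℓ)           ≡⟨ cong₂ _∸_ (Σ-singleton (X (suc ℓ)) n) (Σ-empty (X ℓ) n) ⟩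
        X (suc ℓ) n                                             ≡⟨ cong (X (suc ℓ)) q≡n ⟨
        X (suc ℓ) (p₋ X)                                        ∎) (s≤s z≤n)
        where open ≡-Reasoning

      Invariant : ℕ → Array → Set
      Invariant k X = φ n i m ℓ X ≡ k × Bounded X × RowZeroBefore X i ℓ × S n i X ℓ (p₋ X) ≡ m

      step : ∀ k X → Invariant (suc k) X → ∃ λ Y → f n i m ℓ X ≡ just Y × Invariant k Y
      step k X (φ≡1+k , bounded , rowZero , max≡m) =
        X′ , f-off n i m X (<⇒≢ ℓ<i) φ≡1+k , φ′≡k , moveLeft-Bounded q-lastMax ℓ<i bounded , rowZero′ , max′≡m
        where
        q = p₋ X
        q-lastMax = p₋-lastMax X
        open MoveLeft n i m X d q (occupied X φ≡1+k) hiding (ℓ)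
        open IsLastArgmax q-lastMax using (lower; upper)
        open IsLastArgmax (p₋-lastMax X′) using (maximal) renaming (lower to lower′; upper to upper′)

        rowZero′ : RowZeroBefore X′ i ℓ
        rowZero′ c<ℓ = trans (elsewhere (<⇒≢ c<ℓ) (<⇒≢ (m<n⇒m<1+n c<ℓ))) (rowZero c<ℓ)

        max′≡m : S n i X′ ℓ (p₋ X′) ≡ m
        max′≡m = ≤-antisym (≤-trans (S-moveLeft-≤ q-lastMax lower′ upper′) (≤-reflexive max≡m)) (begin
          m                     ≡⟨ max≡m ⟨
          S n i X ℓ q           ≡⟨ twoColumnSum-at {i} {n} lower upper ⟨
          S n i X′ ℓ q          ≤⟨ maximal lower upper ⟩
          S n i X′ ℓ (p₋ X′)    ∎)
          where open ≤-Reasoning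

        φ′≡k : φ n i m ℓ X′ ≡ k
        φ′≡k = +-cancelʳ-≡ (suc (Σ[ i ⋯ n ] (X ℓ))) _ _ (begin
          φ n i m ℓ X′ + suc (Σ[ i ⋯ n ] (X ℓ))   ≡⟨ cong (φ n i m ℓ X′ +_) (Σ-left-in lower upper) ⟨
          φ n i m ℓ X′ + Σ[ i ⋯ n ] (X′ ℓ)        ≡⟨ φ+column X′ ⟩
          S n i X′ ℓ (p₋ X′)                      ≡⟨ trans max′≡m (sym max≡m) ⟩
          S n i X ℓ q                             ≡⟨ φ+column X ⟨
          φ n i m ℓ X + Σ[ i ⋯ n ] (X ℓ)          ≡⟨ cong (_+ Σ[ i ⋯ n ] (X ℓ)) φ≡1+k ⟩
          suc k + Σ[ i ⋯ n ] (X ℓ)                ≡⟨ +-suc k _ ⟨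
          k + suc (Σ[ i ⋯ n ] (X ℓ))              ∎)
          where open ≡-Reasoning

    offDiagonalStageAt : ∀ {X} → Saturated (suc (suc d)) X → ∃ λ Y → fφ n i m (suc d) X ≡ just Y × Saturated (suc d) Y
    offDiagonalStageAt {X} (bounded , rowZero , column≡m)
      with iterM-countdown (f n i m ℓ) Invariant step (φ n i m ℓ X) X (refl , bounded , rowZero ∘ m<n⇒m<1+n , max≡m)
      where
      open IsLastArgmax (p₋-lastMax X)
      max≡m : S n i X ℓ (p₋ X) ≡ m
      max≡m = ≤-antisym (Bounded⇒S≤m {X} bounded ℓ<i lower upper) (begin
        m                                        ≡⟨ column≡m ⟨
        Σ[ i ⋯ n ] (X (suc ℓ))                   ≡⟨ cong (_+ Σ[ i ⋯ n ] (X (suc ℓ))) (trans (Σ-singleton (X ℓ) i) (rowZero ≤-refl)) ⟨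
        S n i X ℓ i                              ≤⟨ maximal ≤-refl i≤n ⟩
        S n i X ℓ (p₋ X)                         ∎)
        where open ≤-Reasoning
    ... | Y , fφX≡Y , (φ≡0 , boundedY , rowZeroY , maxY≡m) =
      Y , fφX≡Y , boundedY , rowZeroY , trans (cong (_+ Σ[ i ⋯ n ] (Y ℓ)) (sym φ≡0)) (trans (φ+column Y) maxY≡m)

  offDiagonalStage : ∀ {ℓ X} → 0 < ℓ → ℓ < i → Saturated (suc ℓ) X →
    ∃ λ Y → fφ n i m ℓ X ≡ just Y × Saturated ℓ Y
  offDiagonalStage {suc d} _ ℓ<i = offDiagonalStageAt ℓ<i

  Rchain-saturated : ∀ {R} → 2 ≤ i → Bounded R → RowZeroBefore R i i →
    ∀ d → 2 + d ≤ i → ∃ λ X → Rchain n i m R d ≡ just X × Saturated (i ∸ d) X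
  Rchain-saturated 2≤i bounded rowZero zero    _     = diagonalStage (≤-trans (n≤1+n 1) 2≤i) bounded rowZero
  Rchain-saturated 2≤i bounded rowZero (suc d) 3+d≤i
    with Rchain-saturated 2≤i bounded rowZero d (≤-trans (n≤1+n _) 3+d≤i)
  ... | X , R[d]≡X , saturated
    with offDiagonalStage (m<n⇒0<n∸m 1+d<i) (∸-monoʳ-< z<s (<⇒≤ 1+d<i))
                          (subst (λ ℓ → Saturated ℓ X) ℓ+1≡i∸d saturated)
    where
    1+d<i : suc d < i
    1+d<i = ≤-trans (s≤s (n≤1+n (suc d))) 3+d≤i
    ℓ+1≡i∸d : i ∸ d ≡ suc (i ∸ suc d)
    ℓ+1≡i∸d = +-∸-assoc 1 (<⇒≤ 1+d<i)
  ...   | Y , fφX≡Y , saturatedY = Y , trans (cong (_>>= fφ n i m (i ∸ suc d)) R[d]≡X) fφX≡Y , saturatedY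

  Saturated⇒S≡m : ∀ {p X} → Saturated (suc p) X → S n i X p i ≡ m
  Saturated⇒S≡m {p} {X} (_ , rowZero , column≡m) =
    trans (cong (_+ Σ[ i ⋯ n ] (X (suc p))) (trans (Σ-singleton (X p) i) (rowZero ≤-refl))) column≡m

  Saturated⇒M≡m : ∀ {p X} → suc (suc p) ≤ i → Saturated (suc (suc p)) X → M n i X (suc p) ≡ m
  Saturated⇒M≡m {p} {X} p<i saturated@(bounded , _) =
    M≡attained-bound n i X (suc p) i≤n (Saturated⇒S≡m {suc p} {X} saturated) (Bounded⇒S≤m {X} bounded p<i)

  Rchain-column-sums : ∀ {R} → 2 ≤ i → Bounded R → RowZeroBefore R i i → ∀ p → 2 ≤ p → p ≤ i →
    ∃ λ X → Rchain n i m R (i ∸ p) ≡ just X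
      × Σ[ i ⋯ n ] (X p) ≡ m × S n i X (p ∸ 1) i ≡ m × M n i X (p ∸ 1) ≡ m
  Rchain-column-sums 2≤i bounded rowZero p@(suc (suc p′)) 2≤p@(s≤s (s≤s z≤n)) p≤i
    with Rchain-saturated 2≤i bounded rowZero (i ∸ p) 2+[i∸p]≤i
    where
    2+[i∸p]≤i : 2 + (i ∸ p) ≤ i
    2+[i∸p]≤i = begin
      2 + (i ∸ p)   ≡⟨ +-comm 2 (i ∸ p) ⟩
      (i ∸ p) + 2   ≤⟨ +-monoʳ-≤ (i ∸ p) 2≤p ⟩
      (i ∸ p) + p   ≡⟨ m∸n+n≡m p≤i ⟩
      i             ∎
      where open ≤-Reasoning
  ... | X , R[i∸p]≡X , saturated with subst (λ ℓ → Saturated ℓ X) (m∸[m∸n]≡n p≤i) saturated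
  ...   | saturatedₚ@(_ , _ , column≡m) =
    X , R[i∸p]≡X , column≡m , Saturated⇒S≡m {suc p′} {X} saturatedₚ , Saturated⇒M≡m {p′} {X} p≤i saturatedₚ

lemma3p3 : (n i m : ℕ) → 2 ≤ n → 2 ≤ i → i ≤ n → 1 ≤ m →
    (Q : Array) → InB n i m Q → NonZeroArray Q →
    (k : ℕ) → i ≤ k → k ≤ n → RowNonZero i Q k →
    (∀ q → i ≤ q → q < k → ¬ RowNonZero i Q q) →
    ∀ p → 2 ≤ p → p ≤ i →
      ∃ λ X → Rchain n i m (zeroRow k Q) (i ∸ p) ≡ just X
        × Σ[ i ⋯ n ] (X p) ≡ m
        × S n i X (p ∸ 1) i ≡ m
        × M n i X (p ∸ 1) ≡ m
lemma3p3 n i m _ 2≤i i≤n _ Q inB _ k i≤k _ _ minimal =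
  Rchain-column-sums 2≤i bounded (zeroRow-RowZeroBefore inB i≤k minimal)
  where
  open Paths n i m
  open Stages n i m i≤n
  bounded : Bounded (zeroRow k Q)
  bounded = Bounded-mono (zeroRow-≤ k Q) (InB⇒Bounded (≤-trans (n≤1+n 1) 2≤i) inB)
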